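{- Let $(\mathbb P,\ell,c)$ be a $\Sigma$-Prikry triple, $\mathbb P=(P,\le)$, and let $p\in P$. Then: (1) for every $n<\omega$, $W_n(p)$ is a maximal antichain in $\mathbb P{\downarrow}p$; (2) every two compatible elements of $W(p)$ are comparable; (3) for any pair $q'\le q$ in $W(p)$, $q'\in W(q)$; (4) $c\restriction W(p)$ is injective.
   Context: $\mathbb P{\downarrow}p:=\{q\in P\mid q\le p\}$ ($q\le p$: $q$ extends $p$). $\Sigma$-Prikry: Let $\Sigma=\langle\kappa_n\mid n<\omega\rangle$ be a non-decreasing sequence of regular uncountable cardinals converging to $\kappa$, $\mathbb P=(P,\le)$ a notion of forcing with greatest element $1$, $\mu$ a cardinal with $1\Vdash_{\mathbb P}\check\mu=(\check\kappa)^+$. For $\ell:P\to\omega$ and $c$ from $P$ into a set of size $\le\mu$, write $P_n:=\{p\mid\ell(p)=n\}$, $P^p_n:=\{q\le p\mid \ell(q)=\ell(p)+n\}$, $q\le^n p$ iff $q\in P^p_n$. $U\subseteq P$ is $0$-open iff ($r\in U\Leftrightarrow P^r_0\subseteq U$). $(\mathbb P,\ell,c)$ is $\Sigma$-Prikry iff: (S1) $\ell$ surjective, $q\le p\Rightarrow\ell(q)\ge\ell(p)$, each $p$ has $q\le p$ with $\ell(q)=\ell(p)+1$; (S2) each $\mathbb P_n:=(P_n\cup\{1\},\le)$ is $\kappa_n$-directed-closed; (S3) $c(p)=c(q)\Rightarrow P^p_0\cap P^q_0\neq\emptyset$; (S4) for $q\le^{n+m}p$, $\{r\le^n p\mid q\le^m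 r\}$ has a greatest element $m(p,q)$, and $w(p,q):=0(p,q)$; (S5) $|W(p)|<\mu$ where $W(p):=\{w(p,q)\mid q\le p\}$; (S6) for $p'\le p$, $q\mapsto w(p,q)$ is order-preserving $W(p')\to W(p)$; (S7) for every $0$-open $U$, $p\in P$, $n<\omega$ there is $q\le^0p$ with $P^q_n\cap U=\emptyset$ or $P^q_n\subseteq U$. $W_n(p):=\{w(p,q)\mid q\in P^p_n\}$. -}

module Defs where

open import Data.Nat as ℕ using (ℕ; _+_; _∸_)
open import Data.Nat.Properties using (+-identityʳ; m+[n∸m]≡n)
open import Data.Product using (Σ; Σ-syntax; ∃; ∃-syntax; _×_; _,_; proj₁; proj₂)
open import Data.Sum using (_⊎_)
open import Data.Empty using (⊥)
open import Relation.Nullary using (¬_)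
open import Relation.Binary.PropositionalEquality using (_≡_; _≢_; trans; sym; cong)
open import Relation.Binary.Structures using (IsPartialOrder)

-- A Σ-Prikry triple (P, ℓ, c), recording the order-theoretic clauses
-- (S1), (S3), (S4), (S6), (S7).
record SigmaPrikry : Set₁ where
  infix 4 _≤_ _≤[_]_
  field
    P   : Set
    _≤_ : P → P → Set
    isPartialOrder : IsPartialOrder _≡_ _≤_
    𝟙   : P
    𝟙-greatest : ∀ p → p ≤ 𝟙
    ℓ   : P → ℕ
    C   : Set
    c   : P → C

  _≤[_]_ : P → ℕ → P → Set
  q ≤[ n ] p = (q ≤ p) × (ℓ q ≡ ℓ p + n)

  field
    ℓ-surjective : ∀ n → ∃[ p ] ℓ p ≡ n
    ℓ-monotone   : ∀ {p q} → q ≤ p → ℓ p ℕ.≤ ℓ q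
    ℓ-step       : ∀ p → ∃[ q ] q ≤[ 1 ] p
    S3 : ∀ p q → c p ≡ c q → ∃[ r ] (r ≤[ 0 ] p × r ≤[ 0 ] q)
    S4 : ∀ {p q} n m → q ≤[ n + m ] p →
         Σ[ r ∈ P ] (r ≤[ n ] p × q ≤[ m ] r
                     × (∀ r' → r' ≤[ n ] p → q ≤[ m ] r' → r' ≤ r))

  ≤⇒≤[+0] : ∀ {p q} → q ≤ p → q ≤[ (ℓ q ∸ ℓ p) + 0 ] p
  ≤⇒≤[+0] {p} {q} h =
    h , sym (trans (cong (ℓ p +_) (+-identityʳ (ℓ q ∸ ℓ p))) (m+[n∸m]≡n (ℓ-monotone h)))

  w : (p q : P) → q ≤ p → P
  w p q h = proj₁ (S4 (ℓ q ∸ ℓ p) 0 (≤⇒≤[+0] h))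

  W : P → P → Set
  W p x = Σ[ q ∈ P ] Σ[ h ∈ q ≤ p ] w p q h ≡ x

  Wₙ : ℕ → P → P → Set
  Wₙ n p x = Σ[ q ∈ P ] Σ[ h ∈ q ≤[ n ] p ] w p q (proj₁ h) ≡ x

  ZeroOpen : (P → Set) → Set
  ZeroOpen U = ∀ r → (U r → ∀ s → s ≤[ 0 ] r → U s) × ((∀ s → s ≤[ 0 ] r → U s) → U r)

  field
    S6 : ∀ {p p'} (hp : p' ≤ p) {q₁ q₂} (i₁ : W p' q₁) (i₂ : W p' q₂)
           (h₁ : q₁ ≤ p) (h₂ : q₂ ≤ p) → q₁ ≤ q₂ → w p q₁ h₁ ≤ w p q₂ h₂
    S7 : ∀ (U : P → Set) → ZeroOpen U → ∀ p n →
         ∃[ q ] (q ≤[ 0 ] p × ((∀ r → r ≤[ n ] q → ¬ U r) ⊎ (∀ r → r ≤[ n ] q → U r)))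

  -- compatibility inside the cone ℙ↓p (D = below p)
  Below : P → P → Set
  Below p q = q ≤ p

  CompatibleIn : (P → Set) → P → P → Set
  CompatibleIn D x y = ∃[ r ] (D r × r ≤ x × r ≤ y)

  Compatible : P → P → Set
  Compatible x y = ∃[ r ] (r ≤ x × r ≤ y)

  IsAntichainIn : (P → Set) → (P → Set) → Set
  IsAntichainIn D A = (∀ x → A x → D x)
                    × (∀ x y → A x → A y → x ≢ y → ¬ CompatibleIn D x y)

  IsMaximalAntichainIn : (P → Set) → (P → Set) → Set
  IsMaximalAntichainIn D A = IsAntichainIn D A
                           × (∀ r → D r → ∃[ x ] (A x × CompatibleIn D r x))

module Submission where

-- Axiom (S4) says: for q ≤ p and a level k between ℓ p and ℓ q
-- there is a greatest r ≤ p of length k lying above q.  We restate (S4) once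
-- in this level form ('project'), and note that w(p,q) is exactly such a
-- greatest element at level ℓ q ('w-greatest').  Consequently every x ∈ W(p)
-- is "level-maximal" below p: no t ≤ p of the same length strictly above x.
-- The core lemma 'absorb' shows that a level-maximal x ≤ p swallows every
-- z ≤ p of its own length compatible with it: project a common extension r
-- to level ℓ x; the projection lies above x and z, and below x by
-- maximality.  Then
--   (1) elements of Wₙ(p) all have length ℓ p + n, so compatible ones are
--       equal; maximality comes from projecting a deep enough extension;
--   (2) compatible x, y ∈ W(p) with ℓ x ≤ ℓ y: project y to level ℓ x and
--       absorb, giving y ≤ x;
--   (3) for q' ≤ q in W(p), w(q,q') lies above q' at its level, so equals q';
--   (4) equal colours give, by (S3), a common extension of equal length,
--       so x and y absorb each other.

open import Defs
open import Data.Nat using (ℕ; zero; suc; _+_; _∸_)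
import Data.Nat as ℕ
open import Data.Nat.Properties
  using (+-identityʳ; +-assoc; m+[n∸m]≡n; m≤m+n; ≤-total; ≤-trans; ≤-reflexive; +-monoˡ-≤)
open import Data.Product using (_×_; _,_; ∃-syntax; proj₁; proj₂)
open import Data.Sum using (_⊎_; inj₁; inj₂)
open import Relation.Nullary using (¬_)
open import Relation.Binary.PropositionalEquality
  using (_≡_; _≢_; refl; sym; trans; cong; subst; module ≡-Reasoning)
open import Relation.Binary.Structures using (IsPartialOrder)

split-distance : ∀ {a b c} → a ℕ.≤ b → b ℕ.≤ c → c ≡ a + ((b ∸ a) + (c ∸ b))
split-distance {a} {b} {c} a≤b b≤c = sym (begin
  a + ((b ∸ a) + (c ∸ b))  ≡⟨ sym (+-assoc a (b ∸ a) (c ∸ b)) ⟩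
  (a + (b ∸ a)) + (c ∸ b)  ≡⟨ cong (_+ (c ∸ b)) (m+[n∸m]≡n a≤b) ⟩
  b + (c ∸ b)              ≡⟨ m+[n∸m]≡n b≤c ⟩
  c                        ∎)
  where open ≡-Reasoning

module SigmaPrikryFacts (𝕡 : SigmaPrikry) where
  open SigmaPrikry 𝕡
  open IsPartialOrder isPartialOrder using ()
    renaming (refl to ≤ᴾ-refl; trans to ≤ᴾ-trans; antisym to ≤ᴾ-antisym)

  GreatestAt : P → P → ℕ → P → Set
  GreatestAt p q k r =
    r ≤ p × ℓ r ≡ k × q ≤ r × (∀ t → t ≤ p → ℓ t ≡ k → q ≤ t → t ≤ r)

  S4-greatest : ∀ {p q} n m (h : q ≤[ n + m ] p) →
                GreatestAt p q (ℓ p + n) (proj₁ (S4 n m h))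
  S4-greatest {p} {q} n m h@(_ , ℓq) with S4 n m h
  ... | r , (r≤p , ℓr) , (q≤r , _) , greatest =
    r≤p , ℓr , q≤r ,
    λ t t≤p ℓt q≤t → greatest t (t≤p , ℓt) (q≤t , ℓq≡ℓt+m ℓt)
    where
    ℓq≡ℓt+m : ∀ {t} → ℓ t ≡ ℓ p + n → ℓ q ≡ ℓ t + m
    ℓq≡ℓt+m ℓt = trans ℓq (trans (sym (+-assoc (ℓ p) n m)) (cong (_+ m) (sym ℓt)))

  project : ∀ {p q} k → q ≤ p → ℓ p ℕ.≤ k → k ℕ.≤ ℓ q → ∃[ r ] GreatestAt p q k r
  project {p} {q} k q≤p p≤k k≤q =
    r , subst (λ j → GreatestAt p q j r) (m+[n∸m]≡n p≤k) (S4-greatest _ _ h)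
    where
    h : q ≤[ (k ∸ ℓ p) + (ℓ q ∸ k) ] p
    h = q≤p , split-distance p≤k k≤q
    r : P
    r = proj₁ (S4 _ _ h)

  w-greatest : ∀ {p q} (h : q ≤ p) → GreatestAt p q (ℓ q) (w p q h)
  w-greatest {p} {q} h =
    subst (λ j → GreatestAt p q j (w p q h)) (m+[n∸m]≡n (ℓ-monotone h))
          (S4-greatest (ℓ q ∸ ℓ p) 0 (≤⇒≤[+0] h))

  w-length : ∀ {p q} (h : q ≤ p) → ℓ (w p q h) ≡ ℓ q
  w-length h = proj₁ (proj₂ (w-greatest h))

  w-above : ∀ {p q} (h : q ≤ p) → q ≤ w p q h
  w-above h = proj₁ (proj₂ (proj₂ (w-greatest h)))

  LevelMaximal : P → P → Set
  LevelMaximal p x = ∀ t → t ≤ p → ℓ t ≡ ℓ x → x ≤ t → t ≤ x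

  greatest⇒levelMaximal : ∀ {p q k r} → GreatestAt p q k r → LevelMaximal p r
  greatest⇒levelMaximal (_ , ℓr , q≤r , greatest) t t≤p ℓt r≤t =
    greatest t t≤p (trans ℓt ℓr) (≤ᴾ-trans q≤r r≤t)

  W⇒below : ∀ {p x} → W p x → x ≤ p
  W⇒below (q , h , refl) = proj₁ (w-greatest h)

  W⇒levelMaximal : ∀ {p x} → W p x → LevelMaximal p x
  W⇒levelMaximal (q , h , refl) = greatest⇒levelMaximal (w-greatest h)

  absorb : ∀ {p x z r} → x ≤ p → LevelMaximal p x →
           z ≤ p → ℓ z ≡ ℓ x → r ≤ x → r ≤ z → z ≤ x
  absorb {p} {x} {z} {r} x≤p max-x z≤p ℓz r≤x r≤z
    with project (ℓ x) (≤ᴾ-trans r≤x x≤p) (ℓ-monotone x≤p) (ℓ-monotone r≤x)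
  ... | s , s≤p , ℓs , _ , greatest =
    ≤ᴾ-trans (greatest z z≤p ℓz r≤z)
             (max-x s s≤p ℓs (greatest x x≤p refl r≤x))

  W-sameLevel-compatible⇒≡ : ∀ {p x y r} → W p x → W p y →
                              ℓ x ≡ ℓ y → r ≤ x → r ≤ y → x ≡ y
  W-sameLevel-compatible⇒≡ wx wy ℓx≡ℓy r≤x r≤y =
    ≤ᴾ-antisym (absorb (W⇒below wy) (W⇒levelMaximal wy) (W⇒below wx) ℓx≡ℓy r≤y r≤x)
               (absorb (W⇒below wx) (W⇒levelMaximal wx) (W⇒below wy) (sym ℓx≡ℓy) r≤x r≤y)

  descend : ∀ k r → ∃[ r' ] r' ≤[ k ] r
  descend zero r = r , ≤ᴾ-refl , sym (+-identityʳ (ℓ r))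
  descend (suc k) r with ℓ-step r
  ... | r₁ , r₁≤r , ℓr₁ with descend k r₁
  ... | r' , r'≤r₁ , ℓr' =
    r' , ≤ᴾ-trans r'≤r₁ r₁≤r , trans ℓr' (trans (cong (_+ k) ℓr₁) (+-assoc (ℓ r) 1 k))

  Wₙ⇒W : ∀ {n p x} → Wₙ n p x → W p x
  Wₙ⇒W (q , (h , _) , e) = q , h , e

  Wₙ-length : ∀ {n p x} → Wₙ n p x → ℓ x ≡ ℓ p + n
  Wₙ-length (q , (h , ℓq) , refl) = trans (w-length h) ℓq

  -- (1) Wₙ(p) is a maximal antichain below p.  For maximality, extend r to
  -- depth ℓ p + n and project back to that level: w(p,t) meets r.
  Wₙ-maximalAntichain : ∀ p n → IsMaximalAntichainIn (Below p) (Wₙ n p)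
  Wₙ-maximalAntichain p n = ((λ _ wx → W⇒below (Wₙ⇒W wx)) , antichain) , maximal
    where
    antichain : ∀ x y → Wₙ n p x → Wₙ n p y → x ≢ y → ¬ CompatibleIn (Below p) x y
    antichain x y wx wy x≢y (r , _ , r≤x , r≤y) =
      x≢y (W-sameLevel-compatible⇒≡ (Wₙ⇒W wx) (Wₙ⇒W wy)
             (trans (Wₙ-length wx) (sym (Wₙ-length wy))) r≤x r≤y)

    maximal : ∀ r → r ≤ p → ∃[ x ] (Wₙ n p x × CompatibleIn (Below p) r x)
    maximal r r≤p with descend n r
    ... | r' , r'≤r , ℓr'
      with project (ℓ p + n) (≤ᴾ-trans r'≤r r≤p) (m≤m+n (ℓ p) n)
             (≤-trans (+-monoˡ-≤ n (ℓ-monotone r≤p)) (≤-reflexive (sym ℓr')))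
    ... | t , t≤p , ℓt , r'≤t , _ =
      w p t t≤p , (t , (t≤p , ℓt) , refl) ,
      (r' , ≤ᴾ-trans r'≤r r≤p , r'≤r , ≤ᴾ-trans r'≤t (w-above t≤p))

  W-compatible⇒below : ∀ {p x y r} → W p x → W p y →
                       r ≤ x → r ≤ y → ℓ x ℕ.≤ ℓ y → y ≤ x
  W-compatible⇒below wx wy r≤x r≤y ℓx≤ℓy
    with project _ (W⇒below wy) (ℓ-monotone (W⇒below wx)) ℓx≤ℓy
  ... | t , t≤p , ℓt , y≤t , _ =
    ≤ᴾ-trans y≤t (absorb (W⇒below wx) (W⇒levelMaximal wx) t≤p ℓt r≤x (≤ᴾ-trans r≤y y≤t))

  W-compatible⇒comparable : ∀ {p x y} → W p x → W p y → Compatible x y → (x ≤ y) ⊎ (y ≤ x)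
  W-compatible⇒comparable {x = x} {y} wx wy (r , r≤x , r≤y) with ≤-total (ℓ x) (ℓ y)
  ... | inj₁ ℓx≤ℓy = inj₂ (W-compatible⇒below wx wy r≤x r≤y ℓx≤ℓy)
  ... | inj₂ ℓy≤ℓx = inj₁ (W-compatible⇒below wy wx r≤y r≤x ℓy≤ℓx)

  W-below⇒W : ∀ {p q q'} → W p q → W p q' → q' ≤ q → W q q'
  W-below⇒W {q' = q'} wq wq' q'≤q with w-greatest q'≤q
  ... | w≤q , ℓw , q'≤w , _ =
    q' , q'≤q ,
    ≤ᴾ-antisym (W⇒levelMaximal wq' _ (≤ᴾ-trans w≤q (W⇒below wq)) ℓw q'≤w) q'≤w

  W-colour-injective : ∀ {p x y} → W p x → W p y → c x ≡ c y → x ≡ y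
  W-colour-injective {x = x} {y} wx wy cx≡cy with S3 x y cx≡cy
  ... | r , (r≤x , ℓr≡ℓx) , (r≤y , ℓr≡ℓy) =
    W-sameLevel-compatible⇒≡ wx wy
      (trans (sym (+-identityʳ (ℓ x))) (trans (sym ℓr≡ℓx) (trans ℓr≡ℓy (+-identityʳ (ℓ y)))))
      r≤x r≤y

lemma2p8 : (𝕡 : SigmaPrikry) → (p : SigmaPrikry.P 𝕡) →
    let open SigmaPrikry 𝕡 in
    (∀ (n : ℕ) → IsMaximalAntichainIn (Below p) (Wₙ n p))
    × (∀ x y → W p x → W p y → Compatible x y → (x ≤ y) ⊎ (y ≤ x))
    × (∀ q q' → W p q → W p q' → q' ≤ q → W q q')
    × (∀ x y → W p x → W p y → c x ≡ c y → x ≡ y)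
lemma2p8 𝕡 p =
    Wₙ-maximalAntichain p
  , (λ _ _ → W-compatible⇒comparable)
  , (λ _ _ → W-below⇒W)
  , (λ _ _ → W-colour-injective)
  where open SigmaPrikryFacts 𝕡
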